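{- For every $n\ge 0$, $$B(2n,0)=\sum_{\lambda\in\Lambda_n}\prod_{i=1}^n\lambda_i^2,$$ where $B(2n,0)$ is the number of labeled ballot paths from $(0,0)$ ending at $(2n,0)$ (labeled Dyck paths of length $2n$).
   Context: A ballot path of length $m$ is a lattice path from $(0,0)$ with $m$ steps, each an up step $(1,1)$ or a down step $(1,-1)$, never going below the $x$-axis. The height of a step is the smaller $y$-coordinate of its two endpoints. A labeled ballot path is a ballot path in which each step carries an integer label $w$ with $0\le w\le$ the height of that step. An alternate level code of ballots of length $n$ is an integer sequence $\lambda=\lambda_1\cdots\lambda_n$ with $\lambda_1=1$ and $1\le\lambda_j\le\lambda_{j-1}+1$ for $2\le j\le n$; $\Lambda_n$ denotes the set of these. -}

module Defs where

open import Data.Nat using (ℕ; zero; suc; _+_; _*_; _≤_)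
open import Data.List using (List; []; _∷_; [_]; _++_; length; map; concatMap; last)
open import Data.Nat.ListAction using (sum; product)
open import Data.Maybe using (Maybe; just; nothing)
open import Data.Product using (Σ; _×_; _,_)
open import Relation.Binary.PropositionalEquality using (_≡_)

data Step : Set where
  U D : Step

LPath : Set
LPath = List (Step × ℕ)

-- LabeledBallotFrom h p e : the labeled path p, started at height h, never goes
-- below the x-axis, every label w satisfies 0 ≤ w ≤ height of its step
-- (the smaller y-coordinate of its endpoints), and p ends at height e.
data LabeledBallotFrom : ℕ → LPath → ℕ → Set where
  nil  : ∀ {h} → LabeledBallotFrom h [] h
  up   : ∀ {h w p e} → w ≤ h →
         LabeledBallotFrom (suc h) p e → LabeledBallotFrom h ((U , w) ∷ p) e
  down : ∀ {h w p e} → w ≤ h →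
         LabeledBallotFrom h p e → LabeledBallotFrom (suc h) ((D , w) ∷ p) e

LabeledBallot : ℕ → ℕ → Set
LabeledBallot m k = Σ LPath λ p → (length p ≡ m) × LabeledBallotFrom 0 p k

extend : List ℕ → List (List ℕ)
extend c with last c
... | nothing = []
... | just l  = map (λ j → c ++ [ j ]) (range l)
  where
  range : ℕ → List ℕ
  range zero    = [ 1 ]
  range (suc k) = range k ++ [ suc (suc k) ]

-- Λ n : the list of all alternate level codes of ballots of length n
-- (λ₁ = 1, 1 ≤ λⱼ ≤ λⱼ₋₁ + 1); Λ 0 consists of the empty sequence.
Λ : ℕ → List (List ℕ)
Λ zero          = [ [] ]
Λ (suc zero)    = [ [ 1 ] ]
Λ (suc (suc n)) = concatMap extend (Λ (suc n))

levelSum : ℕ → ℕ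
levelSum n = sum (map (λ c → product (map (λ x → x * x) c)) (Λ n))

-- In a labeled Dyck path, an up step leaving height h - 1 and the down step returning to it
-- each carry h labels, and the heights h of the up steps, in order, are exactly an alternate
-- level code; this gives the product of the λᵢ². Instead of building this bijection, both sides
-- are evaluated by one recursion: the total weight extensionWeight k l of the k-entry
-- continuations of a code ending in l is Σ_{j ≤ l + 1} j² · extensionWeight (k - 1) j, and
-- h! · extensionWeight k h counts the labeled ballot paths from height h of length h + 2k
-- down to the axis.
module Submission where

open import Defs
open import Data.Nat using (ℕ; zero; suc; pred; _+_; _*_; _<_; s≤s; _!)
open import Data.Nat.Properties
  using (suc-injective; +-suc; +-comm; +-identityʳ; *-identityˡ; *-identityʳ; *-zeroʳ; *-assoc;
         *-distribˡ-+; m<n⇒m<1+n; n<1+n; <-irrelevant)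
open import Data.Nat.ListAction using (sum; product)
open import Data.Nat.ListAction.Properties using (sum-++; product-++)
open import Data.Nat.Tactic.RingSolver using (solve-∀)
open import Data.Fin using (Fin; toℕ; fromℕ<)
open import Data.Fin.Patterns using (0F)
open import Data.Fin.Properties using (toℕ<n; toℕ-fromℕ<; fromℕ<-toℕ; +↔⊎; *↔×)
open import Data.List using (List; []; _∷_; [_]; _++_; length; map; concatMap; last)
open import Data.List.Properties using (map-++; map-∘; map-id; map-cong)
open import Data.Maybe using (just; nothing; maybe)
open import Data.Product using (Σ; _×_; _,_)
open import Data.Sum using (_⊎_; inj₁; inj₂)
open import Data.Sum.Function.Propositional using (_⊎-↔_)
open import Data.Product.Function.NonDependent.Propositional using (_×-↔_)
open import Function.Bundles using (_↔_; mk↔ₛ′)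
open import Function.Properties.Inverse using (↔-trans)
open import Relation.Binary.PropositionalEquality using (_≡_; refl; sym; trans; cong; cong₂; subst)
open Relation.Binary.PropositionalEquality.≡-Reasoning

sum-map-*ˡ : ∀ {A : Set} a (f : A → ℕ) xs → sum (map (λ x → a * f x) xs) ≡ a * sum (map f xs)
sum-map-*ˡ a f []       = sym (*-zeroʳ a)
sum-map-*ˡ a f (x ∷ xs) = begin
  a * f x + sum (map (λ x → a * f x) xs) ≡⟨ cong (a * f x +_) (sum-map-*ˡ a f xs) ⟩
  a * f x + a * sum (map f xs)          ≡⟨ sym (*-distribˡ-+ a (f x) _) ⟩
  a * (f x + sum (map f xs))            ∎

sum-map-concatMap : ∀ {A B : Set} (ψ : B → ℕ) (g : A → List B) xs →
                    sum (map ψ (concatMap g xs)) ≡ sum (map (λ x → sum (map ψ (g x))) xs)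
sum-map-concatMap ψ g []       = refl
sum-map-concatMap ψ g (x ∷ xs) = begin
  sum (map ψ (g x ++ concatMap g xs))             ≡⟨ cong sum (map-++ ψ (g x) _) ⟩
  sum (map ψ (g x) ++ map ψ (concatMap g xs))     ≡⟨ sum-++ (map ψ (g x)) _ ⟩
  sum (map ψ (g x)) + sum (map ψ (concatMap g xs)) ≡⟨ cong (sum (map ψ (g x)) +_) (sum-map-concatMap ψ g xs) ⟩
  sum (map ψ (g x)) + sum (map (λ x → sum (map ψ (g x))) xs) ∎

oneTo : ℕ → List ℕ
oneTo zero    = [ 1 ]
oneTo (suc l) = oneTo l ++ [ suc (suc l) ]

sum-map-oneTo-suc : ∀ (f : ℕ → ℕ) l → sum (map f (oneTo (suc l))) ≡ sum (map f (oneTo l)) + f (suc (suc l))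
sum-map-oneTo-suc f l = begin
  sum (map f (oneTo l ++ [ suc (suc l) ]))     ≡⟨ cong sum (map-++ f (oneTo l) _) ⟩
  sum (map f (oneTo l) ++ [ f (suc (suc l)) ]) ≡⟨ sum-++ (map f (oneTo l)) _ ⟩
  sum (map f (oneTo l)) + (f (suc (suc l)) + 0) ≡⟨ cong (sum (map f (oneTo l)) +_) (+-identityʳ _) ⟩
  sum (map f (oneTo l)) + f (suc (suc l))       ∎

secondEntry : List ℕ → ℕ
secondEntry (_ ∷ j ∷ _) = j
secondEntry _           = 0

map-secondEntry-pairs : ∀ a xs → map secondEntry (map (λ j → a ∷ j ∷ []) xs) ≡ xs
map-secondEntry-pairs a xs = trans (sym (map-∘ xs)) (map-id xs)

-- The enumeration used by extend is local to its definition, so it is only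
-- reachable through extend [ l ], which unfolds to map (λ j → l ∷ j ∷ []) applied to it.
map-secondEntry-extend : ∀ l → map secondEntry (extend [ l ]) ≡ oneTo l
map-secondEntry-extend zero    = refl
map-secondEntry-extend (suc l) =
  trans (map-secondEntry-pairs (suc l) _)
        (cong (_++ [ suc (suc l) ]) (trans (sym (map-secondEntry-pairs l _)) (map-secondEntry-extend l)))

extend-as-snocs : ∀ c → extend c ≡ maybe (λ l → map (λ j → c ++ [ j ]) (oneTo l)) [] (last c)
extend-as-snocs c with last c
... | nothing = refl
... | just l  =
  cong (map (λ j → c ++ [ j ])) (trans (sym (map-secondEntry-pairs l _)) (map-secondEntry-extend l))

last-∷ʳ : ∀ (c : List ℕ) j → last (c ++ [ j ]) ≡ just j
last-∷ʳ []           j = refl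
last-∷ʳ (_ ∷ [])     j = refl
last-∷ʳ (_ ∷ x ∷ c) j = last-∷ʳ (x ∷ c) j

codeWeight : List ℕ → ℕ
codeWeight c = product (map (λ x → x * x) c)

endWeight : (ℕ → ℕ) → List ℕ → ℕ
endWeight φ c = maybe (λ l → codeWeight c * φ l) 0 (last c)

stepWeight : (ℕ → ℕ) → ℕ → ℕ
stepWeight φ l = sum (map (λ j → j * j * φ j) (oneTo l))

extensionWeight : ℕ → ℕ → ℕ
extensionWeight zero    l = 1
extensionWeight (suc k) l = stepWeight (extensionWeight k) l

codeWeight-∷ʳ : ∀ c j → codeWeight (c ++ [ j ]) ≡ codeWeight c * (j * j * 1)
codeWeight-∷ʳ c j = trans (cong product (map-++ (λ x → x * x) c [ j ]))
                           (product-++ (map (λ x → x * x) c) [ j * j ])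

endWeight-∷ʳ : ∀ φ c j → endWeight φ (c ++ [ j ]) ≡ codeWeight c * (j * j * φ j)
endWeight-∷ʳ φ c j rewrite last-∷ʳ c j | codeWeight-∷ʳ c j = begin
  codeWeight c * (j * j * 1) * φ j ≡⟨ *-assoc (codeWeight c) _ (φ j) ⟩
  codeWeight c * (j * j * 1 * φ j) ≡⟨ cong (λ x → codeWeight c * (x * φ j)) (*-identityʳ (j * j)) ⟩
  codeWeight c * (j * j * φ j)     ∎

sum-map-extend : ∀ (ψ : List ℕ → ℕ) φ → (∀ c j → ψ (c ++ [ j ]) ≡ codeWeight c * (j * j * φ j)) →
                 ∀ c → sum (map ψ (extend c)) ≡ endWeight (stepWeight φ) c
sum-map-extend ψ φ ψ-∷ʳ c rewrite extend-as-snocs c with last c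
... | nothing = refl
... | just l  = begin
  sum (map ψ (map (λ j → c ++ [ j ]) (oneTo l)))           ≡⟨ cong sum (sym (map-∘ (oneTo l))) ⟩
  sum (map (λ j → ψ (c ++ [ j ])) (oneTo l))               ≡⟨ cong sum (map-cong (ψ-∷ʳ c) (oneTo l)) ⟩
  sum (map (λ j → codeWeight c * (j * j * φ j)) (oneTo l)) ≡⟨ sum-map-*ˡ (codeWeight c) _ (oneTo l) ⟩
  codeWeight c * stepWeight φ l                            ∎

sum-map-concatMap-extend : ∀ (ψ : List ℕ → ℕ) φ → (∀ c j → ψ (c ++ [ j ]) ≡ codeWeight c * (j * j * φ j)) →
                           ∀ cs → sum (map ψ (concatMap extend cs)) ≡ sum (map (endWeight (stepWeight φ)) cs)
sum-map-concatMap-extend ψ φ ψ-∷ʳ cs =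
  trans (sum-map-concatMap ψ extend cs) (cong sum (map-cong (sum-map-extend ψ φ ψ-∷ʳ) cs))

sum-endWeight-Λ : ∀ n k → sum (map (endWeight (extensionWeight k)) (Λ (suc n))) ≡ extensionWeight (n + k) 1
sum-endWeight-Λ zero    k = trans (+-identityʳ _) (*-identityˡ _)
sum-endWeight-Λ (suc n) k = begin
  sum (map (endWeight (extensionWeight k)) (concatMap extend (Λ (suc n))))
    ≡⟨ sum-map-concatMap-extend _ (extensionWeight k) (endWeight-∷ʳ (extensionWeight k)) (Λ (suc n)) ⟩
  sum (map (endWeight (extensionWeight (suc k))) (Λ (suc n)))
    ≡⟨ sum-endWeight-Λ n (suc k) ⟩
  extensionWeight (n + suc k) 1
    ≡⟨ cong (λ i → extensionWeight i 1) (+-suc n k) ⟩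
  extensionWeight (suc n + k) 1 ∎

levelSum-extensionWeight : ∀ n → levelSum n ≡ extensionWeight n 0
levelSum-extensionWeight zero          = refl
levelSum-extensionWeight (suc zero)    = refl
levelSum-extensionWeight (suc (suc n)) = begin
  sum (map codeWeight (concatMap extend (Λ (suc n))))
    ≡⟨ sum-map-concatMap-extend codeWeight (λ _ → 1) codeWeight-∷ʳ (Λ (suc n)) ⟩
  sum (map (endWeight (extensionWeight 1)) (Λ (suc n)))
    ≡⟨ sum-endWeight-Λ n 1 ⟩
  extensionWeight (n + 1) 1
    ≡⟨ cong (λ i → extensionWeight i 1) (+-comm n 1) ⟩
  extensionWeight (suc n) 1
    ≡⟨ sym (trans (+-identityʳ _) (*-identityˡ _)) ⟩
  extensionWeight (suc (suc n)) 0 ∎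

BallotsFrom : ℕ → ℕ → Set
BallotsFrom h m = Σ LPath λ p → (length p ≡ m) × LabeledBallotFrom h p 0

Fin↔< : ∀ n → Fin n ↔ Σ ℕ (_< n)
Fin↔< n = mk↔ₛ′ (λ i → toℕ i , toℕ<n i) (λ (w , w<n) → fromℕ< w<n)
                (λ (w , w<n) → bounded-≡ (toℕ-fromℕ< w<n) _ w<n) (λ i → fromℕ<-toℕ i _)
  where
  bounded-≡ : ∀ {v w} → v ≡ w → (v<n : v < n) (w<n : w < n) → (v , v<n) ≡ (w , w<n)
  bounded-≡ refl v<n w<n = cong (_ ,_) (<-irrelevant v<n w<n)

BallotsFrom-suc↔ : ∀ h m → ((Σ ℕ (_< suc h) × BallotsFrom (suc h) m) ⊎ (Σ ℕ (_< h) × BallotsFrom (pred h) m))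
                           ↔ BallotsFrom h (suc m)
BallotsFrom-suc↔ h m = mk↔ₛ′ to from to∘from from∘to
  where
  Split : Set
  Split = (Σ ℕ (_< suc h) × BallotsFrom (suc h) m) ⊎ (Σ ℕ (_< h) × BallotsFrom (pred h) m)
  to : Split → BallotsFrom h (suc m)
  to (inj₁ ((w , s≤s w≤h) , p , refl , r)) = (U , w) ∷ p , refl , up w≤h r
  to (inj₂ ((w , s≤s w≤h′) , p , refl , r)) = (D , w) ∷ p , refl , down w≤h′ r
  from : BallotsFrom h (suc m) → Split
  from ((U , w) ∷ p , refl , up w≤h r)    = inj₁ ((w , s≤s w≤h) , p , refl , r)
  from ((D , w) ∷ p , refl , down w≤h′ r) = inj₂ ((w , s≤s w≤h′) , p , refl , r)
  to∘from : ∀ y → to (from y) ≡ y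
  to∘from ((U , w) ∷ p , refl , up _ _)   = refl
  to∘from ((D , w) ∷ p , refl , down _ _) = refl
  from∘to : ∀ x → from (to x) ≡ x
  from∘to (inj₁ ((w , s≤s _) , p , refl , r)) = refl
  from∘to (inj₂ ((w , s≤s _) , p , refl , r)) = refl

ballotCount : ℕ → ℕ → ℕ
ballotCount h       (suc m) = suc h * ballotCount (suc h) m + h * ballotCount (pred h) m
ballotCount zero    zero    = 1
ballotCount (suc _) zero    = 0

ballotCount-↔ : ∀ h m → Fin (ballotCount h m) ↔ BallotsFrom h m
ballotCount-↔ h (suc m) =
  ↔-trans +↔⊎ (↔-trans (*↔× ⊎-↔ *↔×)
    (↔-trans ((Fin↔< (suc h) ×-↔ ballotCount-↔ (suc h) m) ⊎-↔ (Fin↔< h ×-↔ ballotCount-↔ (pred h) m))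
             (BallotsFrom-suc↔ h m)))
ballotCount-↔ zero zero =
  mk↔ₛ′ (λ _ → [] , refl , nil) (λ _ → 0F) (λ { ([] , refl , nil) → refl }) (λ { 0F → refl ; (Data.Fin.suc ()) })
ballotCount-↔ (suc h) zero = mk↔ₛ′ (λ ()) (λ { ([] , refl , ()) }) (λ { ([] , refl , ()) }) (λ ())

ballotCount-below : ∀ {h m} → m < h → ballotCount h m ≡ 0
ballotCount-below {suc h} {zero}  _          = refl
ballotCount-below {suc h} {suc m} (s≤s m<h) = begin
  suc (suc h) * ballotCount (suc (suc h)) m + suc h * ballotCount h m
    ≡⟨ cong₂ (λ a b → suc (suc h) * a + suc h * b)
             (ballotCount-below (m<n⇒m<1+n (m<n⇒m<1+n m<h))) (ballotCount-below m<h) ⟩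
  suc (suc h) * 0 + suc h * 0
    ≡⟨ cong₂ _+_ (*-zeroʳ (suc (suc h))) (*-zeroʳ (suc h)) ⟩
  0 ∎

stepWeight-suc : ∀ φ l → stepWeight φ (suc l) ≡ stepWeight φ l + suc (suc l) * suc (suc l) * φ (suc (suc l))
stepWeight-suc φ = sum-map-oneTo-suc (λ j → j * j * φ j)

-- The h unmatched down steps, from i + 1 to i for i < h, contribute the factor h!.
ballotCount-extensionWeight : ∀ m h k → m ≡ h + 2 * k → ballotCount h m ≡ h ! * extensionWeight k h
ballotCount-extensionWeight zero    zero    zero    refl = refl
ballotCount-extensionWeight (suc m) zero    (suc k) eq   =
  cong (λ a → 1 * a + 0) (ballotCount-extensionWeight m 1 k (trans (suc-injective eq) (+-suc k (k + 0))))
ballotCount-extensionWeight (suc m) (suc h) zero    eq   = begin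
  suc (suc h) * ballotCount (suc (suc h)) m + suc h * ballotCount h m
    ≡⟨ cong₂ (λ a b → suc (suc h) * a + suc h * b)
             (ballotCount-below m<2+h) (ballotCount-extensionWeight m h zero (suc-injective eq)) ⟩
  suc (suc h) * 0 + suc h * (h ! * 1)
    ≡⟨ rearrange h (h !) ⟩
  suc h * h ! * 1 ∎
  where
  rearrange : ∀ h f → suc (suc h) * 0 + suc h * (f * 1) ≡ suc h * f * 1
  rearrange = solve-∀
  m<2+h : m < suc (suc h)
  m<2+h rewrite suc-injective eq | +-identityʳ h = m<n⇒m<1+n (n<1+n h)
ballotCount-extensionWeight (suc m) (suc h) (suc k) eq   = begin
  suc (suc h) * ballotCount (suc (suc h)) m + suc h * ballotCount h m
    ≡⟨ cong₂ (λ a b → suc (suc h) * a + suc h * b)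
             (ballotCount-extensionWeight m (suc (suc h)) k (trans (suc-injective eq) (shift h k)))
             (ballotCount-extensionWeight m h (suc k) (suc-injective eq)) ⟩
  suc (suc h) * (suc (suc h) ! * extensionWeight k (suc (suc h))) + suc h * (h ! * extensionWeight (suc k) h)
    ≡⟨ rearrange h (h !) (extensionWeight k (suc (suc h))) (extensionWeight (suc k) h) ⟩
  suc h ! * (extensionWeight (suc k) h + suc (suc h) * suc (suc h) * extensionWeight k (suc (suc h)))
    ≡⟨ cong (suc h ! *_) (sym (stepWeight-suc (extensionWeight k) h)) ⟩
  suc h ! * extensionWeight (suc k) (suc h) ∎
  where
  rearrange : ∀ h f a b → suc (suc h) * (suc (suc h) * (suc h * f) * a) + suc h * (f * b)
                      ≡ suc h * f * (b + suc (suc h) * suc (suc h) * a)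
  rearrange = solve-∀
  shift : ∀ h k → h + 2 * suc k ≡ suc (suc h) + 2 * k
  shift = solve-∀

mainTheorem3 : (n : ℕ) → Fin (levelSum n) ↔ LabeledBallot (2 * n) 0
mainTheorem3 n = subst (λ c → Fin c ↔ LabeledBallot (2 * n) 0) (sym levelSum≡ballotCount) (ballotCount-↔ 0 (2 * n))
  where
  levelSum≡ballotCount : levelSum n ≡ ballotCount 0 (2 * n)
  levelSum≡ballotCount = begin
    levelSum n                 ≡⟨ levelSum-extensionWeight n ⟩
    extensionWeight n 0        ≡⟨ sym (*-identityˡ _) ⟩
    0 ! * extensionWeight n 0  ≡⟨ sym (ballotCount-extensionWeight (2 * n) 0 n refl) ⟩
    ballotCount 0 (2 * n)      ∎
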